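{- Let $V,U\in\Sigma_\$^+$ and $z=\max\{|V|,|U|\}$. Then $V=_\omega U$ if and only if $\mathrm{PD}(V^\omega[..3z])=\mathrm{PD}(U^\omega[..3z])$.
   Context: $\Sigma=[0..\sigma]$ is an integer alphabet, $\$\notin\Sigma$ is a symbol smaller than every integer, $\Sigma_\$=\Sigma\cup\{\$\}$, $\infty$ is a symbol larger than every integer. Strings are 1-indexed; $X[..i]=X[1..i]$, $X[i..]=X[i..|X|]$; $X^\omega$ is the infinite concatenation of $X$. Every nonempty $X$ is $Y^k$ for a unique primitive $Y=:\mathrm{root}(X)$. $\mathrm{lcp}(U,V)$ = longest common prefix length; $U<V$ iff $U$ is a proper prefix of $V$ or $U[\ell+1]<V[\ell+1]$ with $\ell=\mathrm{lcp}(U,V)$. $\mathrm{PD}(V)[i]=\infty$ if $V[i]\neq\$$ and $V[i]<V[j]$ for all $j<i$; $=\$$ if $V[i]=\$$; otherwise $i-\max\{j<i:V[j]\le V[i]\}$. $\mathrm{RPD}(V)=\mathrm{PD}(V^2)[|V|+1..]$. $V\preceq_\omega U$ iff there is a natural $i$ with $\mathrm{PD}(V^\omega[..i])<\mathrm{PD}(U^\omega[..i])$ or $\mathrm{root}(\mathrm{RPD}(V))=\mathrm{root}(\mathrm{RPD}(U))$; $V=_\omega U$ iff $V\preceq_\omega U$ and $U\preceq_\omega V$. -}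

module Defs where

open import Data.Nat using (ℕ; zero; suc; _≤ᵇ_; _<_; _*_; _⊔_; _≥_)
open import Data.Fin using (Fin; toℕ)
open import Data.Bool using (Bool; true; false; if_then_else_)
open import Data.List using (List; []; _∷_; _++_; take; drop; length; concat; replicate)
open import Data.Product using (Σ; ∃; _×_; _,_)
open import Data.Sum using (_⊎_)
open import Relation.Binary.PropositionalEquality using (_≡_; _≢_)
open import Relation.Nullary using (¬_)

-- Σ_$ = [0..σ] ∪ {$}, with $ smaller than every integer.
data Sym (σ : ℕ) : Set where
  $   : Sym σ
  ch  : Fin (suc σ) → Sym σ

_≤S_ : {σ : ℕ} → Sym σ → Sym σ → Bool
$    ≤S _    = true
ch _ ≤S $    = false
ch a ≤S ch b = toℕ a ≤ᵇ toℕ b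

data PDSym : Set where
  $ : PDSym
  num : ℕ → PDSym
  ∞ : PDSym

data _<P_ : PDSym → PDSym → Set where
  $<num : ∀ {n} → $ <P num n
  $<∞   : $ <P ∞
  num<num : ∀ {m n} → m < n → num m <P num n
  num<∞ : ∀ {n} → num n <P ∞

-- PD value at a position, given the preceding prefix in reversed order
-- (nearest position first) and the current symbol c.
-- Returns $ if c = $, else the distance to the nearest j < i with V[j] ≤ c,
-- or ∞ if no such j exists (i.e. c < V[j] for all j < i).
pdSearch : {σ : ℕ} → ℕ → List (Sym σ) → Sym σ → PDSym
pdSearch d []       c = ∞
pdSearch d (x ∷ xs) c = if x ≤S c then num d else pdSearch (suc d) xs c

pdAt : {σ : ℕ} → List (Sym σ) → Sym σ → PDSym
pdAt rev $      = $
pdAt rev (ch a) = pdSearch 1 rev (ch a)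

pdGo : {σ : ℕ} → List (Sym σ) → List (Sym σ) → List PDSym
pdGo rev []       = []
pdGo rev (c ∷ cs) = pdAt rev c ∷ pdGo (c ∷ rev) cs

PD : {σ : ℕ} → List (Sym σ) → List PDSym
PD V = pdGo [] V

RPD : {σ : ℕ} → List (Sym σ) → List PDSym
RPD V = drop (length V) (PD (V ++ V))

pow : {A : Set} → List A → ℕ → List A
pow X k = concat (replicate k X)

-- X^ω[..i]; for nonempty X, |X^i| ≥ i, so this is the length-i prefix of X^ω
ωtake : {A : Set} → List A → ℕ → List A
ωtake X i = take i (pow X i)

data _<L_ : List PDSym → List PDSym → Set where
  prefix : ∀ {y ys} → [] <L (y ∷ ys)
  here   : ∀ {x y xs ys} → x <P y → (x ∷ xs) <L (y ∷ ys)
  there  : ∀ {x xs ys} → xs <L ys → (x ∷ xs) <L (x ∷ ys)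

Primitive : {A : Set} → List A → Set
Primitive Y = (Y ≢ []) × ¬ (Σ (List _) λ Z → Σ ℕ λ k → (k ≥ 2) × (Y ≡ pow Z k))

IsRoot : {A : Set} → List A → List A → Set
IsRoot Y X = Primitive Y × Σ ℕ λ k → X ≡ pow Y k

SameRoot : {A : Set} → List A → List A → Set
SameRoot X X' = Σ (List _) λ Y → IsRoot Y X × IsRoot Y X'

_≼ω_ : {σ : ℕ} → List (Sym σ) → List (Sym σ) → Set
V ≼ω U = (Σ ℕ λ i → PD (ωtake V i) <L PD (ωtake U i)) ⊎ SameRoot (RPD V) (RPD U)

_=ω_ : {σ : ℕ} → List (Sym σ) → List (Sym σ) → Set
V =ω U = (V ≼ω U) × (U ≼ω V)

{-# OPTIONS --safe #-}
-- Write n = |V| and v for the sequence V^ω. Going back from a position j ≥ n one meets v[j - n] = v[j]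
-- within n steps, so from position n on PD(V^ω) is the n-periodic extension of RPD(V), and before
-- position n it is that extension with the distances reaching past the start replaced by ∞. Hence
-- PD(V^ω) = PD(U^ω) iff the extensions of RPD(V) and RPD(U) agree, iff RPD(V) and RPD(U) have the
-- same primitive root; otherwise a first difference orders V and U strictly, so V =ω U iff
-- PD(V^ω) = PD(U^ω). If the PD prefixes of length 3z agree, the two extensions agree on [z, 3z), a
-- window of length at least n + m. This gives the extension of RPD(V) the period m as well, hence
-- (Bézout) the period gcd(n, m), and RPD(V), RPD(U) are powers of its prefix of that length.
module Submission where

open import Defs
open import Data.Nat using (ℕ; _*_; _⊔_)
open import Data.List using (List; []; length)
open import Relation.Binary.PropositionalEquality using (_≡_; _≢_)
open import Function.Bundles using (_⇔_)

open import Data.Bool using (T; true; false)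
open import Data.Empty using (⊥-elim)
open import Data.Fin using (toℕ)
open import Data.List using (_∷_; _++_; _∷ʳ_; take; drop; applyUpTo; applyDownFrom; reverseAcc)
open import Data.List.Properties
  using (++-assoc; ++-identityʳ; length-++; ∷-injectiveˡ; ∷-injectiveʳ; ≡-dec;
         applyUpTo-∷ʳ; reverse-applyUpTo; length-applyUpTo; length-applyDownFrom)
open import Data.List.Relation.Unary.Any using (Any; here; there)
open import Data.List.Relation.Unary.Any.Properties using (applyDownFrom⁺)
open import Data.Nat
  using (zero; suc; _+_; _∸_; _≤_; _<_; _≥_; _<?_; _≤?_; z≤n; s≤s; z<s; s<s; NonZero; ≢-nonZero⁻¹; >-nonZero⁻¹)
open import Data.Nat.Properties
  using (_≟_; ≤-refl; ≤-reflexive; ≤-trans; <-irrefl; <-asym; <-cmp; <-≤-trans; <⇒≤; ≤⇒≯; ≤⇒≤ᵇ;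
         m≤n⇒m≤1+n; +-identityʳ; +-suc; +-assoc; +-comm; +-commutativeSemigroup; m≤m+n; m≤n+m; m<m+n;
         +-mono-≤; +-monoˡ-<; +-monoʳ-<; *-zeroʳ; *-suc; *-comm; *-cancelʳ-≡; m*n≢0; m≤m*n; m<m*n;
         m+[n∸m]≡n; m≤m⊔n; m≤n⊔m; anyUpTo?)
open import Algebra.Properties.CommutativeSemigroup +-commutativeSemigroup using (xy∙z≈xz∙y)
open import Data.Nat.DivMod using (_%_; _/_; m≡m%n+[m/n]*n; m%n<n; m<n⇒m%n≡m; [m+n]%n≡m%n)
open import Data.Nat.Divisibility using (_∣_; divides)
open import Data.Nat.GCD using (gcd; gcd-GCD; gcd[m,n]∣m; gcd[m,n]∣n; gcd[m,n]≢0; module Bézout)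
open import Data.Nat.Induction using (<-wellFounded)
open import Data.Product using (Σ; ∃; _×_; _,_)
open import Data.Sum using (_⊎_; inj₁; inj₂)
open import Function.Bundles using (mk⇔)
open import Induction.WellFounded using (Acc; acc)
open import Relation.Binary.Definitions using (DecidableEquality; tri<; tri≈; tri>)
open import Relation.Binary.PropositionalEquality
  using (refl; sym; trans; cong; cong₂; subst; subst₂; _≗_; module ≡-Reasoning)
open import Relation.Nullary using (¬_; Dec; yes; no; contradiction)
open import Relation.Nullary.Decidable using (_×-dec_; map′)

open ≡-Reasoning

private
  variable
    A : Set
    f g : ℕ → A
    k m n p : ℕ

pow-[] : ∀ k → pow {A} [] k ≡ []
pow-[] zero    = refl
pow-[] (suc k) = pow-[] k

pow-+ : (X : List A) (a b : ℕ) → pow X (a + b) ≡ pow X a ++ pow X b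
pow-+ X zero    b = refl
pow-+ X (suc a) b = trans (cong (X ++_) (pow-+ X a b)) (sym (++-assoc X (pow X a) (pow X b)))

pow-* : (X : List A) (a b : ℕ) → pow (pow X a) b ≡ pow X (a * b)
pow-* X a zero    = cong (pow X) (sym (*-zeroʳ a))
pow-* X a (suc b) = begin
  pow X a ++ pow (pow X a) b  ≡⟨ cong (pow X a ++_) (pow-* X a b) ⟩
  pow X a ++ pow X (a * b)    ≡⟨ pow-+ X a (a * b) ⟨
  pow X (a + a * b)           ≡⟨ cong (pow X) (*-suc a b) ⟨
  pow X (a * suc b)           ∎

length-pow : (X : List A) (a : ℕ) → length (pow X a) ≡ a * length X
length-pow X zero    = refl
length-pow X (suc a) = trans (length-++ X) (cong (length X +_) (length-pow X a))

powers-≡-by-length : (Y : List A) {X X′ : List A} {i j : ℕ} →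
                     X ≡ pow Y i → X′ ≡ pow Y j → length X ≡ length X′ → X ≡ X′
powers-≡-by-length []        {i = i} {j} refl refl _        = trans (pow-[] i) (sym (pow-[] j))
powers-≡-by-length Y@(_ ∷ _) {i = i} {j} refl refl |X|≡|X′| =
  cong (pow Y) (*-cancelʳ-≡ i j (length Y) (trans (sym (length-pow Y i)) (trans |X|≡|X′| (length-pow Y j))))

take-length-++ : (xs ys : List A) → take (length xs) (xs ++ ys) ≡ xs
take-length-++ []       ys = refl
take-length-++ (x ∷ xs) ys = cong (x ∷_) (take-length-++ xs ys)

applyUpTo-+ : (f : ℕ → A) (m n : ℕ) → applyUpTo f (m + n) ≡ applyUpTo f m ++ applyUpTo (λ i → f (m + i)) n
applyUpTo-+ f zero    n = refl
applyUpTo-+ f (suc m) n = cong (f 0 ∷_) (applyUpTo-+ (λ i → f (suc i)) m n)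

take-applyUpTo : (f : ℕ → A) → m ≤ n → take m (applyUpTo f n) ≡ applyUpTo f m
take-applyUpTo f z≤n       = refl
take-applyUpTo f (s≤s m≤n) = cong (f 0 ∷_) (take-applyUpTo (λ i → f (suc i)) m≤n)

drop-applyUpTo : (f : ℕ → A) (m n : ℕ) → drop m (applyUpTo f (m + n)) ≡ applyUpTo (λ i → f (m + i)) n
drop-applyUpTo f zero    n = refl
drop-applyUpTo f (suc m) n = drop-applyUpTo (λ i → f (suc i)) m n

applyUpTo-cong : ∀ n → (∀ {i} → i < n → f i ≡ g i) → applyUpTo f n ≡ applyUpTo g n
applyUpTo-cong zero    f≡g = refl
applyUpTo-cong (suc n) f≡g = cong₂ _∷_ (f≡g z<s) (applyUpTo-cong n (λ i<n → f≡g (s<s i<n)))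

applyUpTo-injective : ∀ n → applyUpTo f n ≡ applyUpTo g n → ∀ {i} → i < n → f i ≡ g i
applyUpTo-injective (suc n) f≡g {zero}  _         = ∷-injectiveˡ f≡g
applyUpTo-injective (suc n) f≡g {suc i} (s<s i<n) = applyUpTo-injective n (∷-injectiveʳ f≡g) i<n

applyDownFrom-+ : (f : ℕ → A) (n m : ℕ) →
                  applyDownFrom f (n + m) ≡ applyDownFrom (λ i → f (i + m)) n ++ applyDownFrom f m
applyDownFrom-+ f zero    m = refl
applyDownFrom-+ f (suc n) m = cong (f (n + m) ∷_) (applyDownFrom-+ f n m)

applyDownFrom-cong : ∀ n → f ≗ g → applyDownFrom f n ≡ applyDownFrom g n
applyDownFrom-cong zero    f≗g = refl
applyDownFrom-cong (suc n) f≗g = cong₂ _∷_ (f≗g n) (applyDownFrom-cong n f≗g)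

-- Periodic sequences

Periodic : (ℕ → A) → ℕ → Set
Periodic f p = ∀ j → f (j + p) ≡ f j

periodicˡ : Periodic f p → ∀ j → f (p + j) ≡ f j
periodicˡ {f = f} {p = p} f-p j = trans (cong f (+-comm p j)) (f-p j)

periodic-multiple : Periodic f p → ∀ k → Periodic f (k * p)
periodic-multiple {f = f}         f-p zero    j = cong f (+-identityʳ j)
periodic-multiple {f = f} {p = p} f-p (suc k) j = begin
  f (j + (p + k * p))  ≡⟨ cong f (+-assoc j p (k * p)) ⟨
  f (j + p + k * p)    ≡⟨ periodic-multiple f-p k (j + p) ⟩
  f (j + p)            ≡⟨ f-p j ⟩
  f j                  ∎

periodic-% : .{{_ : NonZero p}} → Periodic f p → ∀ a i → f (a + i) ≡ f (a + i % p)
periodic-% {p = p} {f = f} f-p a i = begin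
  f (a + i)                    ≡⟨ cong (λ t → f (a + t)) (m≡m%n+[m/n]*n i p) ⟩
  f (a + (i % p + i / p * p))  ≡⟨ cong f (+-assoc a (i % p) (i / p * p)) ⟨
  f (a + i % p + i / p * p)    ≡⟨ periodic-multiple f-p (i / p) (a + i % p) ⟩
  f (a + i % p)                ∎

periodic-window-≗ : .{{_ : NonZero p}} → Periodic f p → Periodic g p →
                    ∀ a → (∀ {i} → i < p → f (a + i) ≡ g (a + i)) → f ≗ g
periodic-window-≗ {p = p} {f = f} {g = g} f-p g-p a window j = begin
  f j            ≡⟨ periodic-multiple f-p a j ⟨
  f (j + a * p)  ≡⟨ cong f a+r≡ ⟨
  f (a + r)      ≡⟨ shifted r ⟩
  g (a + r)      ≡⟨ cong g a+r≡ ⟩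
  g (j + a * p)  ≡⟨ periodic-multiple g-p a j ⟩
  g j            ∎
  where
  shifted : ∀ i → f (a + i) ≡ g (a + i)
  shifted i = trans (periodic-% f-p a i) (trans (window (m%n<n i p)) (sym (periodic-% g-p a i)))
  r : ℕ
  r = j + a * p ∸ a
  a+r≡ : a + r ≡ j + a * p
  a+r≡ = m+[n∸m]≡n (≤-trans (m≤m*n a p) (m≤n+m (a * p) j))

window⇒periodic : .{{_ : NonZero n}} → Periodic f n → Periodic g m →
                  ∀ a → (∀ {i} → i < n + m → f (a + i) ≡ g (a + i)) → Periodic f m
window⇒periodic {n = n} {f = f} {g = g} {m = m} f-n g-m a window =
  periodic-window-≗ f+m-n f-n a agree
  where
  f+m-n : Periodic (λ j → f (j + m)) n
  f+m-n j = trans (cong f (xy∙z≈xz∙y j n m)) (f-n (j + m))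
  agree : ∀ {i} → i < n → f (a + i + m) ≡ f (a + i)
  agree {i} i<n = begin
    f (a + i + m)    ≡⟨ cong f (+-assoc a i m) ⟩
    f (a + (i + m))  ≡⟨ window (+-monoˡ-< m i<n) ⟩
    g (a + (i + m))  ≡⟨ cong g (+-assoc a i m) ⟨
    g (a + i + m)    ≡⟨ g-m (a + i) ⟩
    g (a + i)        ≡⟨ window (<-≤-trans i<n (m≤m+n n m)) ⟨
    f (a + i)        ∎

periodic-difference : ∀ {d x y} → Periodic f m → Periodic f n → d + y * n ≡ x * m → Periodic f d
periodic-difference {f = f} {m = m} {n = n} {d = d} {x} {y} f-m f-n eq j = begin
  f (j + d)          ≡⟨ periodic-multiple f-n y (j + d) ⟨
  f (j + d + y * n)  ≡⟨ cong f (trans (+-assoc j d (y * n)) (cong (j +_) eq)) ⟩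
  f (j + x * m)      ≡⟨ periodic-multiple f-m x j ⟩
  f j                ∎

periodic-gcd : Periodic f m → Periodic f n → Periodic f (gcd m n)
periodic-gcd {m = m} {n = n} f-m f-n with Bézout.identity (gcd-GCD m n)
... | Bézout.+- x y eq = periodic-difference {x = x} {y} f-m f-n eq
... | Bézout.-+ x y eq = periodic-difference {x = y} {x} f-n f-m eq

applyUpTo-shift : Periodic f p → ∀ n → applyUpTo (λ i → f (p + i)) n ≡ applyUpTo f n
applyUpTo-shift f-p n = applyUpTo-cong n (λ {i} _ → periodicˡ f-p i)

applyUpTo-periodic : Periodic f p → ∀ k → applyUpTo f (k * p) ≡ pow (applyUpTo f p) k
applyUpTo-periodic                 f-p zero    = refl
applyUpTo-periodic {f = f} {p = p} f-p (suc k) = begin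
  applyUpTo f (p + k * p)                               ≡⟨ applyUpTo-+ f p (k * p) ⟩
  applyUpTo f p ++ applyUpTo (λ i → f (p + i)) (k * p)  ≡⟨ cong (applyUpTo f p ++_) (applyUpTo-shift f-p (k * p)) ⟩
  applyUpTo f p ++ applyUpTo f (k * p)                  ≡⟨ cong (applyUpTo f p ++_) (applyUpTo-periodic f-p k) ⟩
  applyUpTo f p ++ pow (applyUpTo f p) k                ∎

periodic-pow : ∀ {Y : List A} {a} → Periodic f p → applyUpTo f p ≡ pow Y a →
               ∀ k → applyUpTo f (k * p) ≡ pow Y (a * k)
periodic-pow {f = f} {p = p} {Y = Y} {a} f-p f≡Yᵃ k = begin
  applyUpTo f (k * p)    ≡⟨ applyUpTo-periodic f-p k ⟩
  pow (applyUpTo f p) k  ≡⟨ cong (λ X → pow X k) f≡Yᵃ ⟩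
  pow (pow Y a) k        ≡⟨ pow-* Y a k ⟩
  pow Y (a * k)          ∎

ωtake-periodic : .{{_ : NonZero p}} → Periodic f p → ∀ N → ωtake (applyUpTo f p) N ≡ applyUpTo f N
ωtake-periodic {p = p} {f = f} f-p N =
  trans (cong (take N) (sym (applyUpTo-periodic f-p N))) (take-applyUpTo f (m≤m*n N p))

-- Primitive roots

ProperPower : List A → Set
ProperPower {A} w = Σ (List A) λ Z → Σ ℕ λ k → (k ≥ 2) × (w ≡ pow Z k)

properPower-shorter : ∀ {w Z : List A} → w ≢ [] → w ≡ pow Z k → k ≥ 2 → length Z < length w
properPower-shorter {k = k} {Z = []}          w≢[] w≡Zᵏ _   = ⊥-elim (w≢[] (trans w≡Zᵏ (pow-[] k)))
properPower-shorter {k = k} {Z = Z@(_ ∷ _)} _    w≡Zᵏ k≥2 =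
  subst (length Z <_) (sym (trans (cong length w≡Zᵏ) (trans (length-pow Z k) (*-comm k (length Z)))))
        (m<m*n (length Z) k k≥2)

module _ {A : Set} (_≟_ : DecidableEquality A) where

  -- The exponent and the length of the base of a proper power are bounded by the length of the word.
  properPower? : (w : List A) → w ≢ [] → Dec (ProperPower w)
  properPower? w w≢[] = map′ fromBounded toBounded
    (anyUpTo? (λ l → anyUpTo? (λ k → (2 ≤? k) ×-dec ≡-dec _≟_ w (pow (take l w) k)) (suc (length w)))
              (suc (length w)))
    where
    Bounded : Set
    Bounded = ∃ λ l → l < suc (length w) × ∃ λ k → k < suc (length w) × (2 ≤ k × w ≡ pow (take l w) k)
    fromBounded : Bounded → ProperPower w
    fromBounded (l , _ , k , _ , k≥2 , w≡) = take l w , k , k≥2 , w≡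
    toBounded : ProperPower w → Bounded
    toBounded ([] , k , _ , w≡[]ᵏ) = ⊥-elim (w≢[] (trans w≡[]ᵏ (pow-[] k)))
    toBounded (Z@(_ ∷ _) , suc k , k≥2 , w≡Zᵏ) =
      length Z , s≤s (<⇒≤ (properPower-shorter w≢[] w≡Zᵏ k≥2)) ,
      suc k , s≤s (subst (suc k ≤_) (sym |w|≡) (m≤m*n (suc k) (length Z))) ,
      k≥2 , trans w≡Zᵏ (cong (λ X → pow X (suc k)) (sym Z-prefix))
      where
      |w|≡ : length w ≡ suc k * length Z
      |w|≡ = trans (cong length w≡Zᵏ) (length-pow Z (suc k))
      Z-prefix : take (length Z) w ≡ Z
      Z-prefix = trans (cong (take (length Z)) w≡Zᵏ) (take-length-++ Z (pow Z k))

  root : (w : List A) → w ≢ [] → Σ (List A) λ Y → IsRoot Y w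
  root w = go w (<-wellFounded (length w))
    where
    go : (w : List A) → Acc _<_ (length w) → w ≢ [] → Σ (List A) λ Y → IsRoot Y w
    go w (acc shorter) w≢[] with properPower? w w≢[]
    ... | no ¬power = w , (w≢[] , ¬power) , 1 , sym (++-identityʳ w)
    ... | yes (Z , k , k≥2 , w≡Zᵏ) =
      let Y , Y-primitive , j , Z≡Yʲ = go Z (shorter (properPower-shorter w≢[] w≡Zᵏ k≥2)) Z≢[]
      in  Y , Y-primitive , j * k , trans w≡Zᵏ (trans (cong (λ X → pow X k) Z≡Yʲ) (pow-* Y j k))
      where
      Z≢[] : Z ≢ []
      Z≢[] Z≡[] = w≢[] (trans w≡Zᵏ (trans (cong (λ X → pow X k) Z≡[]) (pow-[] k)))

sameRoot-sym : {X X′ : List A} → SameRoot X X′ → SameRoot X′ X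
sameRoot-sym (Y , X-root , X′-root) = Y , X′-root , X-root

periods⇒sameRoot : {f : ℕ → A} → DecidableEquality A → .{{_ : NonZero m}} →
                   Periodic f m → Periodic f n → SameRoot (applyUpTo f m) (applyUpTo f n)
periods⇒sameRoot {m = m} {n = n} {f = f} _≟_ f-m f-n =
  let Y , d-root = root _≟_ (applyUpTo f d) f↾d≢[]
  in  Y , multiple (gcd[m,n]∣m m n) d-root , multiple (gcd[m,n]∣n m n) d-root
  where
  d : ℕ
  d = gcd m n
  multiple : ∀ {Y k} → d ∣ k → IsRoot Y (applyUpTo f d) → IsRoot Y (applyUpTo f k)
  multiple (divides q refl) (Y-primitive , a , f↾d≡Yᵃ) =
    Y-primitive , a * q , periodic-pow {a = a} (periodic-gcd f-m f-n) f↾d≡Yᵃ q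
  f↾d≢[] : applyUpTo f d ≢ []
  f↾d≢[] f↾d≡[] = gcd[m,n]≢0 m n (inj₁ (≢-nonZero⁻¹ m))
                    (trans (sym (length-applyUpTo f d)) (cong length f↾d≡[]))

sameRoot⇒≗ : .{{_ : NonZero m}} .{{_ : NonZero n}} → Periodic f m → Periodic g n →
             SameRoot (applyUpTo f m) (applyUpTo g n) → f ≗ g
sameRoot⇒≗ {m = m} {n = n} {f = f} {g = g} f-m g-n (Y , (_ , a , f↾m≡Yᵃ) , (_ , b , g↾n≡Yᵇ)) =
  periodic-window-≗ {{m*n≢0 n m}} (periodic-multiple f-m n) g-nm 0 (applyUpTo-injective (n * m) f≡g)
  where
  g-nm : Periodic g (n * m)
  g-nm = subst (Periodic g) (*-comm m n) (periodic-multiple g-n m)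
  f≡g : applyUpTo f (n * m) ≡ applyUpTo g (n * m)
  f≡g = powers-≡-by-length Y {i = a * n} {b * m} (periodic-pow {a = a} f-m f↾m≡Yᵃ n)
          (trans (cong (applyUpTo g) (*-comm n m)) (periodic-pow {a = b} g-n g↾n≡Yᵇ m))
          (trans (length-applyUpTo f (n * m)) (sym (length-applyUpTo g (n * m))))

_≟P_ : DecidableEquality PDSym
$     ≟P $     = yes refl
num a ≟P num b = map′ (cong num) (λ { refl → refl }) (a ≟ b)
∞     ≟P ∞     = yes refl
$     ≟P num _ = no λ ()
$     ≟P ∞     = no λ ()
num _ ≟P $     = no λ ()
num _ ≟P ∞     = no λ ()
∞     ≟P $     = no λ ()
∞     ≟P num _ = no λ ()

<P-irrefl : ∀ {a} → ¬ (a <P a)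
<P-irrefl (num<num a<a) = <-irrefl refl a<a

<P-asym : ∀ {a b} → a <P b → ¬ (b <P a)
<P-asym (num<num a<b) (num<num b<a) = <-asym a<b b<a

_<ω_ : (ℕ → PDSym) → (ℕ → PDSym) → Set
f <ω g = ∃ λ p → (∀ {q} → q < p → f q ≡ g q) × f p <P g p

<L-∷⁻ : ∀ {x y xs ys} → (x ∷ xs) <L (y ∷ ys) → x <P y ⊎ (x ≡ y × xs <L ys)
<L-∷⁻ (here x<y)    = inj₁ x<y
<L-∷⁻ (there xs<ys) = inj₂ (refl , xs<ys)

applyUpTo-<L⇒<ω : ∀ N {f g} → applyUpTo f N <L applyUpTo g N → f <ω g
applyUpTo-<L⇒<ω (suc N) f<g with <L-∷⁻ f<g
... | inj₁ f0<g0 = 0 , (λ ()) , f0<g0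
... | inj₂ (f0≡g0 , f′<g′) with applyUpTo-<L⇒<ω N f′<g′
...   | p , agree , fp<gp = suc p , (λ { {zero} _ → f0≡g0 ; {suc q} (s<s q<p) → agree q<p }) , fp<gp

<ω-asym : ∀ {f g} → f <ω g → ¬ (g <ω f)
<ω-asym {f} {g} (p , f≡g , fp<gp) (q , g≡f , gq<fq) with <-cmp p q
... | tri< p<q _ _ = <P-irrefl (subst (f p <P_) (g≡f p<q) fp<gp)
... | tri≈ _ refl _ = <P-asym fp<gp gq<fq
... | tri> _ _ q<p = <P-irrefl (subst (g q <P_) (f≡g q<p) gq<fq)

-- Prev-smaller distances

cut : ℕ → PDSym → PDSym
cut B (num e) with e <? B
... | yes _ = num e
... | no  _ = ∞
cut B x = x

cut-< : ∀ {B e} → e < B → cut B (num e) ≡ num e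
cut-< {B} {e} e<B with e <? B
... | yes _   = refl
... | no  e≮B = contradiction e<B e≮B

cut-≥ : ∀ {B e} → B ≤ e → cut B (num e) ≡ ∞
cut-≥ {B} {e} B≤e with e <? B
... | yes e<B = contradiction e<B (≤⇒≯ B≤e)
... | no  _   = refl

module _ {σ : ℕ} where

  ≤S-refl : (c : Sym σ) → T (c ≤S c)
  ≤S-refl $      = _
  ≤S-refl (ch a) = ≤⇒≤ᵇ (≤-refl {toℕ a})

  Found : Sym σ → List (Sym σ) → Set
  Found c = Any (λ y → T (y ≤S c))

  pdSearch-beyond : ∀ {B} d ys (c : Sym σ) → B ≤ d → cut B (pdSearch d ys c) ≡ ∞
  pdSearch-beyond d []       c B≤d = refl
  pdSearch-beyond d (y ∷ ys) c B≤d with y ≤S c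
  ... | true  = cut-≥ B≤d
  ... | false = pdSearch-beyond (suc d) ys c (m≤n⇒m≤1+n B≤d)

  pdSearch-cut : ∀ {B} d xs (c : Sym σ) → d + length xs ≤ B → cut B (pdSearch d xs c) ≡ pdSearch d xs c
  pdSearch-cut d []       c _     = refl
  pdSearch-cut d (x ∷ xs) c bound with x ≤S c
  ... | true  = cut-< (<-≤-trans (m<m+n d z<s) bound)
  ... | false = pdSearch-cut (suc d) xs c (≤-trans (≤-reflexive (sym (+-suc d (length xs)))) bound)

  pdSearch-++-cut : ∀ d xs ys (c : Sym σ) → pdSearch d xs c ≡ cut (d + length xs) (pdSearch d (xs ++ ys) c)
  pdSearch-++-cut d []       ys c = sym (pdSearch-beyond d ys c (≤-reflexive (+-identityʳ d)))
  pdSearch-++-cut d (x ∷ xs) ys c with x ≤S c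
  ... | true  = sym (cut-< (m<m+n d z<s))
  ... | false = trans (pdSearch-++-cut (suc d) xs ys c)
                      (cong (λ B → cut B (pdSearch (suc d) (xs ++ ys) c)) (sym (+-suc d (length xs))))

  pdSearch-++-found : ∀ d {xs} ys {c : Sym σ} → Found c xs → pdSearch d (xs ++ ys) c ≡ pdSearch d xs c
  pdSearch-++-found d {x ∷ xs} ys {c} (here x≤c) with x ≤S c
  ... | true = refl
  pdSearch-++-found d {x ∷ xs} ys {c} (there found) with x ≤S c
  ... | true  = refl
  ... | false = pdSearch-++-found (suc d) ys found

  pdAt-cut : ∀ (c : Sym σ) xs {B} → suc (length xs) ≤ B → cut B (pdAt xs c) ≡ pdAt xs c
  pdAt-cut $      xs _     = refl
  pdAt-cut (ch a) xs bound = pdSearch-cut 1 xs (ch a) bound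

  pdAt-++-cut : ∀ (c : Sym σ) xs ys → pdAt xs c ≡ cut (suc (length xs)) (pdAt (xs ++ ys) c)
  pdAt-++-cut $      xs ys = refl
  pdAt-++-cut (ch a) xs ys = pdSearch-++-cut 1 xs ys (ch a)

  pdAt-++-found : ∀ {c : Sym σ} {xs} ys → Found c xs → pdAt (xs ++ ys) c ≡ pdAt xs c
  pdAt-++-found {$}    ys _     = refl
  pdAt-++-found {ch a} ys found = pdSearch-++-found 1 ys found

  pdGo-∷ʳ : ∀ (r xs : List (Sym σ)) x → pdGo r (xs ∷ʳ x) ≡ pdGo r xs ∷ʳ pdAt (reverseAcc r xs) x
  pdGo-∷ʳ r []       x = refl
  pdGo-∷ʳ r (y ∷ xs) x = cong (pdAt r y ∷_) (pdGo-∷ʳ (y ∷ r) xs x)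

  -- PDω v j is PD(v)[j + 1], positions of sequences being counted from 0. For p-periodic v,
  -- RPDω v p is the periodic extension of RPD(v[..p]).
  PDω : (ℕ → Sym σ) → ℕ → PDSym
  PDω v j = pdAt (applyDownFrom v j) (v j)

  RPDω : (ℕ → Sym σ) → ℕ → ℕ → PDSym
  RPDω v p j = PDω v (p + j)

  PD-applyUpTo : ∀ (v : ℕ → Sym σ) N → PD (applyUpTo v N) ≡ applyUpTo (PDω v) N
  PD-applyUpTo v zero    = refl
  PD-applyUpTo v (suc N) = begin
    PD (applyUpTo v (suc N))
      ≡⟨ cong PD (applyUpTo-∷ʳ v N) ⟨
    PD (applyUpTo v N ∷ʳ v N)
      ≡⟨ pdGo-∷ʳ [] (applyUpTo v N) (v N) ⟩
    PD (applyUpTo v N) ∷ʳ pdAt (reverseAcc [] (applyUpTo v N)) (v N)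
      ≡⟨ cong₂ (λ ps past → ps ∷ʳ pdAt past (v N)) (PD-applyUpTo v N) (reverse-applyUpTo v N) ⟩
    applyUpTo (PDω v) N ∷ʳ PDω v N
      ≡⟨ applyUpTo-∷ʳ (PDω v) N ⟩
    applyUpTo (PDω v) (suc N) ∎

  module _ (v : ℕ → Sym σ) {p : ℕ} .{{_ : NonZero p}} (v-p : Periodic v p) where

    -- At position p + j the symbol p steps back is v j = v (p + j) itself, so the search stops
    -- within one period.
    RPDω-window : ∀ j → RPDω v p j ≡ pdAt (applyDownFrom (λ i → v (i + j)) p) (v j)
    RPDω-window j = begin
      pdAt (applyDownFrom v (p + j)) (v (p + j))
        ≡⟨ cong₂ pdAt (applyDownFrom-+ v p j) (periodicˡ v-p j) ⟩
      pdAt (applyDownFrom (λ i → v (i + j)) p ++ applyDownFrom v j) (v j)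
        ≡⟨ pdAt-++-found (applyDownFrom v j)
                         (applyDownFrom⁺ (λ i → v (i + j)) (≤S-refl (v j)) (>-nonZero⁻¹ p)) ⟩
      pdAt (applyDownFrom (λ i → v (i + j)) p) (v j) ∎

    RPDω-periodic : Periodic (RPDω v p) p
    RPDω-periodic j = begin
      RPDω v p (j + p)
        ≡⟨ RPDω-window (j + p) ⟩
      pdAt (applyDownFrom (λ i → v (i + (j + p))) p) (v (j + p))
        ≡⟨ cong₂ pdAt (applyDownFrom-cong p (λ i → trans (cong v (sym (+-assoc i j p))) (v-p (i + j))))
                      (v-p j) ⟩
      pdAt (applyDownFrom (λ i → v (i + j)) p) (v j)
        ≡⟨ RPDω-window j ⟨
      RPDω v p j ∎

    PDω-cut : ∀ j → PDω v j ≡ cut (suc j) (RPDω v p j)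
    PDω-cut j = begin
      pdAt (applyDownFrom v j) (v j)
        ≡⟨ pdAt-++-cut (v j) (applyDownFrom v j) (applyDownFrom v p) ⟩
      cut (suc (length (applyDownFrom v j))) (pdAt (applyDownFrom v j ++ applyDownFrom v p) (v j))
        ≡⟨ cong₂ (λ l c → cut (suc l) c) (length-applyDownFrom v j)
                 (cong₂ pdAt past (sym (periodicˡ v-p j))) ⟩
      cut (suc j) (RPDω v p j) ∎
      where
      past : applyDownFrom v j ++ applyDownFrom v p ≡ applyDownFrom v (p + j)
      past = begin
        applyDownFrom v j ++ applyDownFrom v p                 ≡⟨ cong (_++ _) (applyDownFrom-cong j v-p) ⟨
        applyDownFrom (λ i → v (i + p)) j ++ applyDownFrom v p ≡⟨ applyDownFrom-+ v j p ⟨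
        applyDownFrom v (j + p)                                ≡⟨ cong (applyDownFrom v) (+-comm j p) ⟩
        applyDownFrom v (p + j)                                ∎

    PDω-late : ∀ {j} → p ≤ j → PDω v j ≡ RPDω v p j
    PDω-late {j} p≤j = begin
      PDω v j                     ≡⟨ PDω-cut j ⟩
      cut (suc j) (RPDω v p j)    ≡⟨ cong (cut (suc j)) (RPDω-window j) ⟩
      cut (suc j) (pdAt W (v j))  ≡⟨ pdAt-cut (v j) W (s≤s |W|≤j) ⟩
      pdAt W (v j)                ≡⟨ RPDω-window j ⟨
      RPDω v p j                  ∎
      where
      W : List (Sym σ)
      W = applyDownFrom (λ i → v (i + j)) p
      |W|≤j : length W ≤ j
      |W|≤j = ≤-trans (≤-reflexive (length-applyDownFrom _ p)) p≤j

    PD-ωtake-periodic : ∀ N → PD (ωtake (applyUpTo v p) N) ≡ applyUpTo (PDω v) N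
    PD-ωtake-periodic N = trans (cong PD (ωtake-periodic v-p N)) (PD-applyUpTo v N)

    RPD-periodic : RPD (applyUpTo v p) ≡ applyUpTo (RPDω v p) p
    RPD-periodic = begin
      drop (length (applyUpTo v p)) (PD (applyUpTo v p ++ applyUpTo v p))
        ≡⟨ cong₂ (λ l X → drop l (PD X)) (length-applyUpTo v p) square ⟩
      drop p (PD (applyUpTo v (p + p)))
        ≡⟨ cong (drop p) (PD-applyUpTo v (p + p)) ⟩
      drop p (applyUpTo (PDω v) (p + p))
        ≡⟨ drop-applyUpTo (PDω v) p p ⟩
      applyUpTo (RPDω v p) p ∎
      where
      square : applyUpTo v p ++ applyUpTo v p ≡ applyUpTo v (p + p)
      square = sym (trans (applyUpTo-+ v p p) (cong (applyUpTo v p ++_) (applyUpTo-shift v-p p)))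

lookupOr : A → List A → ℕ → A
lookupOr d []       _       = d
lookupOr d (y ∷ ys) zero    = y
lookupOr d (y ∷ ys) (suc i) = lookupOr d ys i

applyUpTo-lookupOr : (d : A) (ys : List A) → applyUpTo (lookupOr d ys) (length ys) ≡ ys
applyUpTo-lookupOr d []       = refl
applyUpTo-lookupOr d (y ∷ ys) = cong (y ∷_) (applyUpTo-lookupOr d ys)

-- The default x is never used, since j % length (x ∷ xs) < length (x ∷ xs).
cycle : A → List A → ℕ → A
cycle x xs j = lookupOr x (x ∷ xs) (j % length (x ∷ xs))

cycle-periodic : (x : A) (xs : List A) → Periodic (cycle x xs) (length (x ∷ xs))
cycle-periodic x xs j = cong (lookupOr x (x ∷ xs)) ([m+n]%n≡m%n j (length (x ∷ xs)))

applyUpTo-cycle : (x : A) (xs : List A) → applyUpTo (cycle x xs) (length (x ∷ xs)) ≡ x ∷ xs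
applyUpTo-cycle x xs =
  trans (applyUpTo-cong (length (x ∷ xs)) (λ i<n → cong (lookupOr x (x ∷ xs)) (m<n⇒m%n≡m i<n)))
        (applyUpTo-lookupOr x (x ∷ xs))

-- Comparing two words

module _ {σ : ℕ} (v u : ℕ → Sym σ) {n m : ℕ} .{{_ : NonZero n}} .{{_ : NonZero m}}
         (v-n : Periodic v n) (u-m : Periodic u m) where

  sameRoot⇒PDω-≗ : SameRoot (applyUpTo (RPDω v n) n) (applyUpTo (RPDω u m) m) → PDω v ≗ PDω u
  sameRoot⇒PDω-≗ same j = begin
    PDω v j                   ≡⟨ PDω-cut v v-n j ⟩
    cut (suc j) (RPDω v n j)  ≡⟨ cong (cut (suc j)) RPD-v≡RPD-u ⟩
    cut (suc j) (RPDω u m j)  ≡⟨ PDω-cut u u-m j ⟨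
    PDω u j                   ∎
    where
    RPD-v≡RPD-u : RPDω v n j ≡ RPDω u m j
    RPD-v≡RPD-u = sameRoot⇒≗ {f = RPDω v n} {g = RPDω u m} (RPDω-periodic v v-n) (RPDω-periodic u u-m) same j

  -- On [z, 3z) with z = n ⊔ m the PD values are RPD values, and a common window of length n + m
  -- forces the two RPD sequences to share their periods n and m, hence to coincide.
  PDω-prefix⇒sameRoot : (∀ {j} → j < 3 * (n ⊔ m) → PDω v j ≡ PDω u j) →
                        SameRoot (applyUpTo (RPDω v n) n) (applyUpTo (RPDω u m) m)
  PDω-prefix⇒sameRoot agree =
    subst (SameRoot (applyUpTo (RPDω v n) n)) (applyUpTo-cong m (λ {i} _ → RPD-v≗RPD-u i))
          (periods⇒sameRoot _≟P_ (RPDω-periodic v v-n) RPD-v-m)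
    where
    z : ℕ
    z = n ⊔ m
    in-range : ∀ {i} → i < n + m → z + i < 3 * z
    in-range i<n+m =
      +-monoʳ-< z (<-≤-trans i<n+m (+-mono-≤ (m≤m⊔n n m) (≤-trans (m≤n⊔m n m) (m≤m+n z 0))))
    window : ∀ {i} → i < n + m → RPDω v n (z + i) ≡ RPDω u m (z + i)
    window {i} i<n+m = begin
      RPDω v n (z + i)  ≡⟨ PDω-late v v-n (≤-trans (m≤m⊔n n m) (m≤m+n z i)) ⟨
      PDω v (z + i)     ≡⟨ agree (in-range i<n+m) ⟩
      PDω u (z + i)     ≡⟨ PDω-late u u-m (≤-trans (m≤n⊔m n m) (m≤m+n z i)) ⟩
      RPDω u m (z + i)  ∎
    RPD-v-m : Periodic (RPDω v n) m
    RPD-v-m = window⇒periodic (RPDω-periodic v v-n) (RPDω-periodic u u-m) z window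
    RPD-v≗RPD-u : RPDω v n ≗ RPDω u m
    RPD-v≗RPD-u =
      periodic-window-≗ RPD-v-m (RPDω-periodic u u-m) z (λ i<m → window (<-≤-trans i<m (m≤n+m m n)))

module _ {σ : ℕ} (x : Sym σ) (xs : List (Sym σ)) where

  PD-ωtake-cycle : ∀ N → PD (ωtake (x ∷ xs) N) ≡ applyUpTo (PDω (cycle x xs)) N
  PD-ωtake-cycle N = trans (cong (λ V → PD (ωtake V N)) (sym (applyUpTo-cycle x xs)))
                           (PD-ωtake-periodic (cycle x xs) (cycle-periodic x xs) N)

  RPD-cycle : RPD (x ∷ xs) ≡ applyUpTo (RPDω (cycle x xs) (length (x ∷ xs))) (length (x ∷ xs))
  RPD-cycle = trans (cong RPD (sym (applyUpTo-cycle x xs))) (RPD-periodic (cycle x xs) (cycle-periodic x xs))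

module _ {σ : ℕ} (x : Sym σ) (xs : List (Sym σ)) (y : Sym σ) (ys : List (Sym σ)) where

  private
    V U : List (Sym σ)
    V = x ∷ xs
    U = y ∷ ys

  sameRoot⇒PD-≡ : SameRoot (RPD V) (RPD U) → ∀ N → PD (ωtake V N) ≡ PD (ωtake U N)
  sameRoot⇒PD-≡ same N = begin
    PD (ωtake V N)                   ≡⟨ PD-ωtake-cycle x xs N ⟩
    applyUpTo (PDω (cycle x xs)) N   ≡⟨ applyUpTo-cong {f = PDω (cycle x xs)} N (λ {j} _ → PDω-≗ j) ⟩
    applyUpTo (PDω (cycle y ys)) N   ≡⟨ PD-ωtake-cycle y ys N ⟨
    PD (ωtake U N)                   ∎
    where
    PDω-≗ : PDω (cycle x xs) ≗ PDω (cycle y ys)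
    PDω-≗ = sameRoot⇒PDω-≗ (cycle x xs) (cycle y ys) (cycle-periodic x xs) (cycle-periodic y ys)
              (subst₂ SameRoot (RPD-cycle x xs) (RPD-cycle y ys) same)

  PD-≡⇒sameRoot : PD (ωtake V (3 * (length V ⊔ length U))) ≡ PD (ωtake U (3 * (length V ⊔ length U))) →
                  SameRoot (RPD V) (RPD U)
  PD-≡⇒sameRoot PD-≡ =
    subst₂ SameRoot (sym (RPD-cycle x xs)) (sym (RPD-cycle y ys))
      (PDω-prefix⇒sameRoot (cycle x xs) (cycle y ys) (cycle-periodic x xs) (cycle-periodic y ys)
        (applyUpTo-injective {f = PDω (cycle x xs)} {PDω (cycle y ys)} N PDω-≡))
    where
    N : ℕ
    N = 3 * (length V ⊔ length U)
    PDω-≡ : applyUpTo (PDω (cycle x xs)) N ≡ applyUpTo (PDω (cycle y ys)) N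
    PDω-≡ = trans (sym (PD-ωtake-cycle x xs N)) (trans PD-≡ (PD-ωtake-cycle y ys N))

  PD-<L⇒<ω : ∀ N → PD (ωtake V N) <L PD (ωtake U N) → PDω (cycle x xs) <ω PDω (cycle y ys)
  PD-<L⇒<ω N V<U = applyUpTo-<L⇒<ω N {PDω (cycle x xs)} {PDω (cycle y ys)}
                     (subst₂ _<L_ (PD-ωtake-cycle x xs N) (PD-ωtake-cycle y ys N) V<U)

lemma5 : (σ : ℕ) (V U : List (Sym σ)) → V ≢ [] → U ≢ [] →
    (V =ω U) ⇔ (PD (ωtake V (3 * (length V ⊔ length U))) ≡ PD (ωtake U (3 * (length V ⊔ length U))))
lemma5 σ []       _        V≢[] _    = ⊥-elim (V≢[] refl)
lemma5 σ _        []       _    U≢[] = ⊥-elim (U≢[] refl)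
lemma5 σ (x ∷ xs) (y ∷ ys) _    _    = mk⇔ to from
  where
  N : ℕ
  N = 3 * (length (x ∷ xs) ⊔ length (y ∷ ys))
  to : (x ∷ xs) =ω (y ∷ ys) → PD (ωtake (x ∷ xs) N) ≡ PD (ωtake (y ∷ ys) N)
  to (inj₂ same , _)                    = sameRoot⇒PD-≡ x xs y ys same N
  to (_ , inj₂ same)                    = sameRoot⇒PD-≡ x xs y ys (sameRoot-sym same) N
  to (inj₁ (i , V<U) , inj₁ (i′ , U<V)) =
    ⊥-elim (<ω-asym (PD-<L⇒<ω x xs y ys i V<U) (PD-<L⇒<ω y ys x xs i′ U<V))
  from : PD (ωtake (x ∷ xs) N) ≡ PD (ωtake (y ∷ ys) N) → (x ∷ xs) =ω (y ∷ ys)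
  from PD-≡ = let same = PD-≡⇒sameRoot x xs y ys PD-≡ in inj₂ same , inj₂ (sameRoot-sym same)
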